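{- There are exactly $2^{\aleph_0}$ Epstein incomplete extensions of $\mathcal{F}$, i.e. $2^{\aleph_0}$ logics that are Epstein incomplete.
   Context: Let $\Phi=\{p_0,p_1,\dots\}$ be a countably infinite set of propositional letters; $\mathsf{FOR}$ is the set of formulas built from $\Phi$ with $\neg$ and binary $\lor,\wedge,\to,\leftrightarrow,\vartriangle,\looparrowright$. An Epstein model is $\langle v,\mathfrak{R}\rangle$ with $v:\Phi\to\{0,1\}$ and $\mathfrak{R}\subseteq\mathsf{FOR}^2$ (an Epstein relation). Truth: $\langle v,\mathfrak{R}\rangle\vDash p$ iff $v(p)=1$; classical clauses for $\neg,\wedge,\lor,\to,\leftrightarrow$; $\vDash\psi\vartriangle\chi$ iff both $\psi,\chi$ true and $\langle\psi,\chi\rangle\in\mathfrak{R}$; $\vDash\psi\looparrowright\chi$ iff ($\psi$ false or $\chi$ true) and $\langle\psi,\chi\rangle\in\mathfrak{R}$. $\mathfrak{R}\vDash\varphi$ iff $\langle v,\mathfrak{R}\rangle\vDash\varphi$ for every $v$; $X\vDash\varphi$ iff $\mathfrak{R}\vDash\varphi$ for all $\mathfrak{R}\in X$. $\mathcal{F}$ is the least set of formulas containing all classical tautologies, $(p\looparrowright q)\to(p\to q)$ and $(p\vartriangle q)\leftrightarrow((p\looparrowright q)\wedge(p\wedge q))$, closed under uniform substitution and modus ponens. A logic is a set of formulas containing $\mathcal{F}$ closed under uniform substitution and modus ponens. A logic $\lambda$ is Epstein complete iff $\lambda=\{\varphi:X\vDash\varphi\}$ for some set $X$ of Epstein relations;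 otherwise it is Epstein incomplete. -}

module Defs where

open import Data.Nat using (ℕ)
open import Data.Bool using (Bool; true; false; not; _∧_; _∨_; if_then_else_)
open import Data.Product using (Σ; _×_; _,_)
open import Data.Empty using (⊥)
open import Relation.Nullary using (¬_)
open import Relation.Binary.PropositionalEquality using (_≡_)
open import Function.Bundles using (_⇔_)

infixr 5 _⇒_ _⇔'_
infixr 6 _∨'_
infixr 7 _∧'_

data Formula : Set where
  var   : ℕ → Formula
  ¬'_   : Formula → Formula
  _∨'_  : Formula → Formula → Formula
  _∧'_  : Formula → Formula → Formula
  _⇒_   : Formula → Formula → Formula
  _⇔'_  : Formula → Formula → Formula
  _△_   : Formula → Formula → Formula
  _↬_   : Formula → Formula → Formula

_⇒ᵇ_ : Bool → Bool → Bool
a ⇒ᵇ b = not a ∨ b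

_⇔ᵇ_ : Bool → Bool → Bool
a ⇔ᵇ b = (a ⇒ᵇ b) ∧ (b ⇒ᵇ a)

Valuation : Set
Valuation = ℕ → Bool

EpsteinRelation : Set
EpsteinRelation = Formula → Formula → Bool

⟦_⟧ : Formula → Valuation → EpsteinRelation → Bool
⟦ var p ⟧ v R = v p
⟦ ¬' φ ⟧ v R = not (⟦ φ ⟧ v R)
⟦ φ ∨' ψ ⟧ v R = ⟦ φ ⟧ v R ∨ ⟦ ψ ⟧ v R
⟦ φ ∧' ψ ⟧ v R = ⟦ φ ⟧ v R ∧ ⟦ ψ ⟧ v R
⟦ φ ⇒ ψ ⟧ v R = ⟦ φ ⟧ v R ⇒ᵇ ⟦ ψ ⟧ v R
⟦ φ ⇔' ψ ⟧ v R = ⟦ φ ⟧ v R ⇔ᵇ ⟦ ψ ⟧ v R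
⟦ φ △ ψ ⟧ v R = (⟦ φ ⟧ v R ∧ ⟦ ψ ⟧ v R) ∧ R φ ψ
⟦ φ ↬ ψ ⟧ v R = (⟦ φ ⟧ v R ⇒ᵇ ⟦ ψ ⟧ v R) ∧ R φ ψ

_⊨ᴿ_ : EpsteinRelation → Formula → Set
R ⊨ᴿ φ = ∀ (v : Valuation) → ⟦ φ ⟧ v R ≡ true

_⊨ˣ_ : (EpsteinRelation → Set) → Formula → Set
X ⊨ˣ φ = ∀ R → X R → R ⊨ᴿ φ

-- Classical tautologies: formulas true under every classical
-- evaluation in which the non-classical subformulas (ψ △ χ, ψ ↬ χ)
-- are treated as atoms, i.e. substitution instances of propositional
-- tautologies.

classical : (Formula → Bool) → Formula → Bool
classical a (var p) = a (var p)
classical a (¬' φ) = not (classical a φ)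
classical a (φ ∨' ψ) = classical a φ ∨ classical a ψ
classical a (φ ∧' ψ) = classical a φ ∧ classical a ψ
classical a (φ ⇒ ψ) = classical a φ ⇒ᵇ classical a ψ
classical a (φ ⇔' ψ) = classical a φ ⇔ᵇ classical a ψ
classical a (φ △ ψ) = a (φ △ ψ)
classical a (φ ↬ ψ) = a (φ ↬ ψ)

Tautology : Formula → Set
Tautology φ = ∀ (a : Formula → Bool) → classical a φ ≡ true

Substitution : Set
Substitution = ℕ → Formula

_[_] : Formula → Substitution → Formula
var p [ s ] = s p
(¬' φ) [ s ] = ¬' (φ [ s ])
(φ ∨' ψ) [ s ] = (φ [ s ]) ∨' (ψ [ s ])
(φ ∧' ψ) [ s ] = (φ [ s ]) ∧' (ψ [ s ])
(φ ⇒ ψ) [ s ] = (φ [ s ]) ⇒ (ψ [ s ])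
(φ ⇔' ψ) [ s ] = (φ [ s ]) ⇔' (ψ [ s ])
(φ △ ψ) [ s ] = (φ [ s ]) △ (ψ [ s ])
(φ ↬ ψ) [ s ] = (φ [ s ]) ↬ (ψ [ s ])

p q : Formula
p = var 0
q = var 1

axiom1 : Formula
axiom1 = (p ↬ q) ⇒ (p ⇒ q)

axiom2 : Formula
axiom2 = (p △ q) ⇔' ((p ↬ q) ∧' (p ∧' q))

data 𝓕 : Formula → Set where
  taut  : ∀ {φ} → Tautology φ → 𝓕 φ
  ax1   : 𝓕 axiom1
  ax2   : 𝓕 axiom2
  subst : ∀ {φ} (s : Substitution) → 𝓕 φ → 𝓕 (φ [ s ])
  mp    : ∀ {φ ψ} → 𝓕 (φ ⇒ ψ) → 𝓕 φ → 𝓕 ψ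

FormulaSet : Set₁
FormulaSet = Formula → Set

_≐_ : FormulaSet → FormulaSet → Set
L ≐ M = ∀ φ → L φ ⇔ M φ

record IsLogic (L : FormulaSet) : Set where
  field
    contains𝓕  : ∀ {φ} → 𝓕 φ → L φ
    closedSubst : ∀ {φ} (s : Substitution) → L φ → L (φ [ s ])
    closedMP    : ∀ {φ ψ} → L (φ ⇒ ψ) → L φ → L ψ

EpsteinComplete : FormulaSet → Set₁
EpsteinComplete L = Σ (EpsteinRelation → Set) λ X → L ≐ (X ⊨ˣ_)

EpsteinIncomplete : FormulaSet → Set₁
EpsteinIncomplete L = ¬ EpsteinComplete L

IncompleteLogic : FormulaSet → Set₁
IncompleteLogic L = IsLogic L × EpsteinIncomplete L

-- Λ a is the logic of the pointed models ⟨ v , R ⟩ in which R φ φ is the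
-- truth value of φ at v, and R relates φ to ¬²⁽ⁿ⁺¹⁾ φ whenever a n holds.
-- These classes are closed under substitution, so each Λ a is a logic.  It
-- contains (p ↬ p) ↔ p, which forces R p p to depend on the valuation and so
-- is valid in no Epstein relation; as Λ a is consistent it is not the theory
-- of any set of relations.  Over each valuation a canonical admissible point
-- relates φ to ¬²⁽ⁿ⁺¹⁾ φ exactly when a n holds, hence p ↬ ¬²⁽ⁿ⁺¹⁾ p ∈ Λ a
-- iff a n, and a ↦ Λ a is injective.  The upper bound is a Gödel numbering.

module Submission where

open import Defs
open import Data.Nat using (ℕ)
open import Data.Bool using (Bool)
open import Data.Product using (Σ; _×_)
open import Relation.Binary.PropositionalEquality using (_≡_)

open import Data.Nat using (zero; suc; _+_; _<_)
import Data.Nat as ℕ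
open import Data.Nat.Properties using (n<1+n; m<n⇒m<1+n; <-irrefl)
open import Data.Nat.Binary as ℕᵇ using (ℕᵇ; 2[1+_]; 1+[2_]; toℕ)
open import Data.Nat.Binary.Properties using (toℕ-injective)
open import Data.Bool using (true; false; not; _∧_; _∨_)
open import Data.Bool.Properties using (not-involutive; ∧-conicalʳ; ∨-zeroʳ)
open import Data.Product using (_,_; proj₁; proj₂; map₁; uncurry)
open import Data.List using (List; []; _∷_)
open import Data.Empty using (⊥-elim)
open import Function using (_∘_)
open import Function.Bundles using (_⇔_; mk⇔; Equivalence)
open import Function.Construct.Composition using (_⇔-∘_)
open import Function.Construct.Symmetry using (⇔-sym)
open import Relation.Nullary using (¬_; yes; no)
open import Relation.Nullary.Decidable using (map′)
open import Relation.Binary.Definitions using (DecidableEquality)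
open import Relation.Binary.PropositionalEquality
  using (refl; sym; trans; cong; cong₂; _≢_; ≡-≟-identity; ≢-≟-identity)
  renaming (subst to transport)

ones : ℕ → ℕᵇ → ℕᵇ
ones zero    k = k
ones (suc t) k = 1+[2 ones t k ]

-- Token t is written as t one-bits closed by a zero-bit.
token : ℕ → ℕᵇ → ℕᵇ
token t k = 2[1+ ones t k ]

-- Polish notation: encode φ k prepends the code of φ to the code k.
encode : Formula → ℕᵇ → ℕᵇ
encode (var n)  k = token (7 + n) k
encode (¬' φ)   k = token 0 (encode φ k)
encode (φ ∨' ψ) k = token 1 (encode φ (encode ψ k))
encode (φ ∧' ψ) k = token 2 (encode φ (encode ψ k))
encode (φ ⇒ ψ)  k = token 3 (encode φ (encode ψ k))
encode (φ ⇔' ψ) k = token 4 (encode φ (encode ψ k))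
encode (φ △ ψ)  k = token 5 (encode φ (encode ψ k))
encode (φ ↬ ψ)  k = token 6 (encode φ (encode ψ k))

Stack : Set
Stack = List Formula

push : ℕ → Stack → Stack
push 0 (φ ∷ st)         = (¬' φ) ∷ st
push 1 (φ ∷ ψ ∷ st)     = (φ ∨' ψ) ∷ st
push 2 (φ ∷ ψ ∷ st)     = (φ ∧' ψ) ∷ st
push 3 (φ ∷ ψ ∷ st)     = (φ ⇒ ψ) ∷ st
push 4 (φ ∷ ψ ∷ st)     = (φ ⇔' ψ) ∷ st
push 5 (φ ∷ ψ ∷ st)     = (φ △ ψ) ∷ st
push 6 (φ ∷ ψ ∷ st)     = (φ ↬ ψ) ∷ st
push (suc (suc (suc (suc (suc (suc (suc n))))))) st = var n ∷ st
push _ st               = st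

-- A stack machine reading the bits innermost (i.e. last) first; the number
-- counts the one-bits of the token being read.
parse : ℕᵇ → ℕ × Stack
parse ℕᵇ.zero   = 0 , []
parse 2[1+ k ]  = 0 , uncurry push (parse k)
parse 1+[2 k ]  = map₁ suc (parse k)

parse-ones : ∀ t {k st} → parse k ≡ (0 , st) → parse (ones t k) ≡ (t , st)
parse-ones zero    h = h
parse-ones (suc t) h = cong (map₁ suc) (parse-ones t h)

parse-token : ∀ t {k st} → parse k ≡ (0 , st) → parse (token t k) ≡ (0 , push t st)
parse-token t h = cong (λ r → 0 , uncurry push r) (parse-ones t h)

parse-encode : ∀ φ {k st} → parse k ≡ (0 , st) → parse (encode φ k) ≡ (0 , φ ∷ st)
parse-encode (var n)  h = parse-token (7 + n) h
parse-encode (¬' φ)   h = parse-token 0 (parse-encode φ h)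
parse-encode (φ ∨' ψ) h = parse-token 1 (parse-encode φ (parse-encode ψ h))
parse-encode (φ ∧' ψ) h = parse-token 2 (parse-encode φ (parse-encode ψ h))
parse-encode (φ ⇒ ψ)  h = parse-token 3 (parse-encode φ (parse-encode ψ h))
parse-encode (φ ⇔' ψ) h = parse-token 4 (parse-encode φ (parse-encode ψ h))
parse-encode (φ △ ψ)  h = parse-token 5 (parse-encode φ (parse-encode ψ h))
parse-encode (φ ↬ ψ)  h = parse-token 6 (parse-encode φ (parse-encode ψ h))

code : Formula → ℕ
code φ = toℕ (encode φ ℕᵇ.zero)

code-injective : ∀ {φ ψ} → code φ ≡ code ψ → φ ≡ ψ
code-injective {φ} {ψ} eq
  with trans (sym (parse-encode φ refl))
             (trans (cong parse (toℕ-injective eq)) (parse-encode ψ refl))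
... | refl = refl

_≟_ : DecidableEquality Formula
φ ≟ ψ = map′ code-injective (cong code) (code φ ℕ.≟ code ψ)

substᵛ : Substitution → Valuation → EpsteinRelation → Valuation
substᵛ s v R n = ⟦ s n ⟧ v R

substᴿ : Substitution → EpsteinRelation → EpsteinRelation
substᴿ s R φ ψ = R (φ [ s ]) (ψ [ s ])

⟦[]⟧ : ∀ s v R φ → ⟦ φ [ s ] ⟧ v R ≡ ⟦ φ ⟧ (substᵛ s v R) (substᴿ s R)
⟦[]⟧ s v R (var n)  = refl
⟦[]⟧ s v R (¬' φ)   = cong not (⟦[]⟧ s v R φ)
⟦[]⟧ s v R (φ ∨' ψ) = cong₂ _∨_ (⟦[]⟧ s v R φ) (⟦[]⟧ s v R ψ)
⟦[]⟧ s v R (φ ∧' ψ) = cong₂ _∧_ (⟦[]⟧ s v R φ) (⟦[]⟧ s v R ψ)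
⟦[]⟧ s v R (φ ⇒ ψ)  = cong₂ _⇒ᵇ_ (⟦[]⟧ s v R φ) (⟦[]⟧ s v R ψ)
⟦[]⟧ s v R (φ ⇔' ψ) = cong₂ _⇔ᵇ_ (⟦[]⟧ s v R φ) (⟦[]⟧ s v R ψ)
⟦[]⟧ s v R (φ △ ψ)  =
  cong₂ (λ x y → (x ∧ y) ∧ substᴿ s R φ ψ) (⟦[]⟧ s v R φ) (⟦[]⟧ s v R ψ)
⟦[]⟧ s v R (φ ↬ ψ)  =
  cong₂ (λ x y → (x ⇒ᵇ y) ∧ substᴿ s R φ ψ) (⟦[]⟧ s v R φ) (⟦[]⟧ s v R ψ)

⟦⟧≡classical : ∀ v R φ → ⟦ φ ⟧ v R ≡ classical (λ χ → ⟦ χ ⟧ v R) φ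
⟦⟧≡classical v R (var n)  = refl
⟦⟧≡classical v R (¬' φ)   = cong not (⟦⟧≡classical v R φ)
⟦⟧≡classical v R (φ ∨' ψ) = cong₂ _∨_ (⟦⟧≡classical v R φ) (⟦⟧≡classical v R ψ)
⟦⟧≡classical v R (φ ∧' ψ) = cong₂ _∧_ (⟦⟧≡classical v R φ) (⟦⟧≡classical v R ψ)
⟦⟧≡classical v R (φ ⇒ ψ)  = cong₂ _⇒ᵇ_ (⟦⟧≡classical v R φ) (⟦⟧≡classical v R ψ)
⟦⟧≡classical v R (φ ⇔' ψ) = cong₂ _⇔ᵇ_ (⟦⟧≡classical v R φ) (⟦⟧≡classical v R ψ)
⟦⟧≡classical v R (φ △ ψ)  = refl
⟦⟧≡classical v R (φ ↬ ψ)  = refl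

⇒ᵇ-mp : ∀ x {y} → (x ⇒ᵇ y) ≡ true → x ≡ true → y ≡ true
⇒ᵇ-mp true h refl = h

∧-⇒ᵇ-elimˡ : ∀ x y → (x ∧ y) ⇒ᵇ x ≡ true
∧-⇒ᵇ-elimˡ true  y = ∨-zeroʳ (not y)
∧-⇒ᵇ-elimˡ false y = refl

axiom2-truthTable : ∀ x y z → ((x ∧ y) ∧ z) ⇔ᵇ (((x ⇒ᵇ y) ∧ z) ∧ (x ∧ y)) ≡ true
axiom2-truthTable true  true  true  = refl
axiom2-truthTable true  true  false = refl
axiom2-truthTable true  false z     = refl
axiom2-truthTable false y     true  = refl
axiom2-truthTable false y     false = refl

𝓕-sound : ∀ {φ} → 𝓕 φ → ∀ v R → ⟦ φ ⟧ v R ≡ true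
𝓕-sound (taut {φ} t) v R = trans (⟦⟧≡classical v R φ) (t _)
𝓕-sound ax1          v R = ∧-⇒ᵇ-elimˡ (v 0 ⇒ᵇ v 1) (R p q)
𝓕-sound ax2          v R = axiom2-truthTable (v 0) (v 1) (R p q)
𝓕-sound (subst {φ} s d) v R = trans (⟦[]⟧ s v R φ) (𝓕-sound d _ _)
𝓕-sound (mp d e)     v R = ⇒ᵇ-mp _ (𝓕-sound d v R) (𝓕-sound e v R)

PointClass : Set₁
PointClass = Valuation → EpsteinRelation → Set

Theory : PointClass → FormulaSet
Theory P φ = ∀ v R → P v R → ⟦ φ ⟧ v R ≡ true

SubstClosed : PointClass → Set
SubstClosed P = ∀ s v R → P v R → P (substᵛ s v R) (substᴿ s R)

Theory-isLogic : ∀ {P} → SubstClosed P → IsLogic (Theory P)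
Theory-isLogic closed = record
  { contains𝓕   = λ d v R _ → 𝓕-sound d v R
  ; closedSubst = λ {φ} s h v R x → trans (⟦[]⟧ s v R φ) (h _ _ (closed s v R x))
  ; closedMP    = λ h₁ h₂ v R x → ⇒ᵇ-mp _ (h₁ v R x) (h₂ v R x)
  }

reflexiveTruth : Formula
reflexiveTruth = (p ↬ p) ⇔' p

reflexiveTruth-unsatisfiable : ∀ R → ¬ (R ⊨ᴿ reflexiveTruth)
reflexiveTruth-unsatisfiable R h with R p p | h (λ _ → true) | h (λ _ → false)
... | true  | _  | ()
... | false | () | _

reflexiveTruth∈⇒incomplete : ∀ {L φ} → L reflexiveTruth → ¬ L φ → EpsteinIncomplete L
reflexiveTruth∈⇒incomplete {φ = φ} refl∈L φ∉L (X , L≐X) = φ∉L (Equivalence.from (L≐X φ) X⊨φ)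
  where
  X⊨φ : X ⊨ˣ φ
  X⊨φ R R∈X = ⊥-elim (reflexiveTruth-unsatisfiable R
                        (Equivalence.to (L≐X reflexiveTruth) refl∈L R R∈X))

dneg : ℕ → Formula → Formula
dneg zero    φ = ¬' ¬' φ
dneg (suc n) φ = ¬' ¬' dneg n φ

⟦dneg⟧ : ∀ n φ v R → ⟦ dneg n φ ⟧ v R ≡ ⟦ φ ⟧ v R
⟦dneg⟧ zero    φ v R = not-involutive _
⟦dneg⟧ (suc n) φ v R = trans (not-involutive _) (⟦dneg⟧ n φ v R)

dneg-[] : ∀ s n φ → dneg n φ [ s ] ≡ dneg n (φ [ s ])
dneg-[] s zero    φ = refl
dneg-[] s (suc n) φ = cong (¬'_ ∘ ¬'_) (dneg-[] s n φ)

leadingNegations : Formula → ℕ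
leadingNegations (¬' φ) = suc (leadingNegations φ)
leadingNegations _      = 0

leadingNegations-dneg : ∀ n φ → leadingNegations φ < leadingNegations (dneg n φ)
leadingNegations-dneg zero    φ = m<n⇒m<1+n (n<1+n _)
leadingNegations-dneg (suc n) φ = m<n⇒m<1+n (m<n⇒m<1+n (leadingNegations-dneg n φ))

dneg-≢ : ∀ n φ → φ ≢ dneg n φ
dneg-≢ n φ eq = <-irrefl (cong leadingNegations eq) (leadingNegations-dneg n φ)

-- ladder a φ (dneg n φ) = a n; every other off-diagonal pair is related.
ladder : (ℕ → Bool) → Formula → Formula → Bool
ladder a φ (¬' ¬' ψ) with φ ≟ ψ
... | yes _ = a 0
... | no  _ = ladder (a ∘ suc) φ ψ
ladder a φ _ = true

ladder-dneg : ∀ a n φ → ladder a φ (dneg n φ) ≡ a n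
ladder-dneg a zero    φ rewrite ≡-≟-identity _≟_ {φ} refl = refl
ladder-dneg a (suc n) φ rewrite ≢-≟-identity _≟_ (dneg-≢ n φ) = ladder-dneg (a ∘ suc) n φ

record Admissible (a : ℕ → Bool) (v : Valuation) (R : EpsteinRelation) : Set where
  field
    diagonal : ∀ φ → R φ φ ≡ ⟦ φ ⟧ v R
    rungs    : ∀ n → a n ≡ true → ∀ φ → R φ (dneg n φ) ≡ true

Admissible-substClosed : ∀ a → SubstClosed (Admissible a)
Admissible-substClosed a s v R adm = record
  { diagonal = λ φ → trans (diagonal (φ [ s ])) (⟦[]⟧ s v R φ)
  ; rungs    = λ n an φ → trans (cong (R (φ [ s ])) (dneg-[] s n φ)) (rungs n an (φ [ s ]))
  }
  where open Admissible adm

Λ : (ℕ → Bool) → FormulaSet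
Λ a = Theory (Admissible a)

module CanonicalPoint (a : ℕ → Bool) (v : Valuation) where

  relateWithDiagonal : Bool → Formula → Formula → Bool
  relateWithDiagonal x φ ψ with φ ≟ ψ
  ... | yes _ = x
  ... | no  _ = ladder a φ ψ

  -- ⟦_⟧ v rel unfolded, so that rel is defined by structural recursion.
  eval : Formula → Bool
  eval (var n)  = v n
  eval (¬' φ)   = not (eval φ)
  eval (φ ∨' ψ) = eval φ ∨ eval ψ
  eval (φ ∧' ψ) = eval φ ∧ eval ψ
  eval (φ ⇒ ψ)  = eval φ ⇒ᵇ eval ψ
  eval (φ ⇔' ψ) = eval φ ⇔ᵇ eval ψ
  eval (φ △ ψ)  = (eval φ ∧ eval ψ) ∧ relateWithDiagonal (eval φ) φ ψ
  eval (φ ↬ ψ)  = (eval φ ⇒ᵇ eval ψ) ∧ relateWithDiagonal (eval φ) φ ψ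

  rel : EpsteinRelation
  rel φ ψ = relateWithDiagonal (eval φ) φ ψ

  ⟦⟧≡eval : ∀ φ → ⟦ φ ⟧ v rel ≡ eval φ
  ⟦⟧≡eval (var n)  = refl
  ⟦⟧≡eval (¬' φ)   = cong not (⟦⟧≡eval φ)
  ⟦⟧≡eval (φ ∨' ψ) = cong₂ _∨_ (⟦⟧≡eval φ) (⟦⟧≡eval ψ)
  ⟦⟧≡eval (φ ∧' ψ) = cong₂ _∧_ (⟦⟧≡eval φ) (⟦⟧≡eval ψ)
  ⟦⟧≡eval (φ ⇒ ψ)  = cong₂ _⇒ᵇ_ (⟦⟧≡eval φ) (⟦⟧≡eval ψ)
  ⟦⟧≡eval (φ ⇔' ψ) = cong₂ _⇔ᵇ_ (⟦⟧≡eval φ) (⟦⟧≡eval ψ)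
  ⟦⟧≡eval (φ △ ψ)  = cong₂ (λ x y → (x ∧ y) ∧ rel φ ψ) (⟦⟧≡eval φ) (⟦⟧≡eval ψ)
  ⟦⟧≡eval (φ ↬ ψ)  = cong₂ (λ x y → (x ⇒ᵇ y) ∧ rel φ ψ) (⟦⟧≡eval φ) (⟦⟧≡eval ψ)

  rel-dneg : ∀ n φ → rel φ (dneg n φ) ≡ a n
  rel-dneg n φ rewrite ≢-≟-identity _≟_ (dneg-≢ n φ) = ladder-dneg a n φ

  admissible : Admissible a v rel
  admissible = record
    { diagonal = λ φ → trans (rel-diagonal φ) (sym (⟦⟧≡eval φ))
    ; rungs    = λ n an φ → trans (rel-dneg n φ) an
    }
    where
    rel-diagonal : ∀ φ → rel φ φ ≡ eval φ
    rel-diagonal φ rewrite ≡-≟-identity _≟_ {φ} refl = refl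

reflexiveTruth∈Λ : ∀ a → Λ a reflexiveTruth
reflexiveTruth∈Λ a v R adm rewrite Admissible.diagonal adm p = truthTable (v 0)
  where
  truthTable : ∀ x → ((x ⇒ᵇ x) ∧ x) ⇔ᵇ x ≡ true
  truthTable true  = refl
  truthTable false = refl

p∉Λ : ∀ a → ¬ Λ a p
p∉Λ a p∈Λ with () ← p∈Λ (λ _ → false) _ (CanonicalPoint.admissible a (λ _ → false))

Λ-incompleteLogic : ∀ a → IncompleteLogic (Λ a)
Λ-incompleteLogic a =
  Theory-isLogic (Admissible-substClosed a) ,
  reflexiveTruth∈⇒incomplete {Λ a} {p} (reflexiveTruth∈Λ a) (p∉Λ a)

rung : ℕ → Formula
rung n = p ↬ dneg n p

rung∈Λ⇔ : ∀ a n → Λ a (rung n) ⇔ (a n ≡ true)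
rung∈Λ⇔ a n = mk⇔ to from
  where
  to : Λ a (rung n) → a n ≡ true
  to rung∈Λ = ∧-conicalʳ _ _ (trans (cong (⟦ dneg n p ⟧ (λ _ → true) rel ∧_) (sym (rel-dneg n p)))
                                    (rung∈Λ (λ _ → true) rel admissible))
    where open CanonicalPoint a (λ _ → true)
  from : a n ≡ true → Λ a (rung n)
  from an v R adm
    rewrite ⟦dneg⟧ n p v R | Admissible.rungs adm n an p = truthTable (v 0)
    where
    truthTable : ∀ x → (x ⇒ᵇ x) ∧ true ≡ true
    truthTable true  = refl
    truthTable false = refl

≡true-injective : ∀ {x y} → (x ≡ true ⇔ y ≡ true) → x ≡ y
≡true-injective {true}  {true}  _ = refl
≡true-injective {false} {false} _ = refl
≡true-injective {true}  {false} h = sym (Equivalence.to h refl)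
≡true-injective {false} {true}  h = Equivalence.from h refl

Λ-injective : ∀ a b → Λ a ≐ Λ b → ∀ n → a n ≡ b n
Λ-injective a b Λa≐Λb n =
  ≡true-injective (rung∈Λ⇔ b n ⇔-∘ (Λa≐Λb (rung n) ⇔-∘ ⇔-sym (rung∈Λ⇔ a n)))

codes : FormulaSet → ℕ → Set
codes L n = Σ Formula λ φ → code φ ≡ n × L φ

codes-injective : ∀ L M → (∀ n → (codes L n → codes M n) × (codes M n → codes L n)) → L ≐ M
codes-injective L M same φ = mk⇔ (transfer L M (proj₁ ∘ same)) (transfer M L (proj₂ ∘ same))
  where
  transfer : ∀ L M → (∀ n → codes L n → codes M n) → L φ → M φ
  transfer L M f φ∈L with f (code φ) (φ , refl , φ∈L)
  ... | ψ , eq , ψ∈M = transport M (code-injective eq) ψ∈M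

mainTheorem5 : (Σ ((ℕ → Bool) → FormulaSet) λ Λ →
                   ((∀ a → IncompleteLogic (Λ a))
                    × (∀ a b → Λ a ≐ Λ b → ∀ n → a n ≡ b n)))
               × (Σ (FormulaSet → (ℕ → Set)) λ e →
                   (∀ L M → IncompleteLogic L → IncompleteLogic M
                      → (∀ n → (e L n → e M n) × (e M n → e L n)) → L ≐ M))
mainTheorem5 = (Λ , Λ-incompleteLogic , Λ-injective) , (codes , λ L M _ _ → codes-injective L M)
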